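{- Player $2$ has a constructive strategy for winning an Empty Board $F_4$ Black Hole Zeckendorf game for any $n \equiv 0,2,4,6,9,11,13 \pmod{16}$ such that $n\neq 2, 32$ in which case Player $1$ has the winning strategy. Player $1$ has a constructive strategy for winning an Empty Board $F_4$ Black Hole Zeckendorf game for any $n \equiv 1,3,5,7,8,10,12,14,15 \pmod{16}$, such that $n\neq 17,47$, in which case Player $2$ has the winning strategy.
   Context: Fibonacci numbers are indexed so that $F_1=1$, $F_2=2$, $F_3=3$, $F_4=5$, $F_{k+1}=F_k+F_{k-1}$. The Empty Board $F_4$ Black Hole Zeckendorf game is played on a board with three columns $F_1,F_2,F_3$ (weights $1,2,3$); a board state $(a,b,c)$ means $a$, $b$, $c$ pieces in columns $F_1,F_2,F_3$ respectively. The game starts from the empty board $(0,0,0)$ and a positive integer $n$. Placement phase: players alternate (Player $1$ first), each placing one piece in one of the outermost columns $F_1$ or $F_3$ (never $F_2$); placing in column $F_i$ uses up $F_i$ of the remaining value, and is only allowed if $F_i$ is at most the remaining value; this phase ends when the weighted sum of the board equals $n$, so the resulting board has the form $(a,0,c)$. The last player to place a piece moves second in the decomposition phase. Decomposition phase: players alternate choosing among the moves: Add (remove one piece from each of $F_i$ and $F_{i+1}$ and place one piece on $F_{i+2}$), Merge (remove two pieces from $F_1$ and place one on $F_2$), Split (remove two pieces from $F_2$ and place one on $F_1$ and one on $F_3$; for $i\ge 3$, two pieces from $F_i$ to one on $F_{i-2}$ and one on $F_{i+1}$). Any piece that would be placed on column $F_4$ (or beyond) falls into the ``black hole'' and is permanently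 removed from play. The last player to move wins (normal play). -}

module Defs where

open import Data.Nat using (ℕ; zero; suc; _%_)
open import Data.List using (List; _∷_; [])
open import Data.List.Membership.Propositional using (_∈_)

-- Positions of the Empty Board F_4 Black Hole Zeckendorf game.
--   place a c r : placement phase, a pieces on F1, c pieces on F3,
--                 r (> 0) value still to be placed.
--   decomp a b c : decomposition phase, board (a , b , c) on F1 F2 F3.
-- Moves strictly alternate between the two players throughout the whole
-- game (the last placer moves second in the decomposition phase, i.e. the
-- other player makes the first decomposition move).
data Position : Set where
  place  : ℕ → ℕ → ℕ → Position
  decomp : ℕ → ℕ → ℕ → Position

afterPlace : ℕ → ℕ → ℕ → Position
afterPlace a c zero    = decomp a 0 c
afterPlace a c (suc r) = place a c (suc r)

start : ℕ → Position
start n = afterPlace 0 0 n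

-- Legal moves.  Pieces sent to F4 fall into the black hole.
data _⟶_ : Position → Position → Set where
  put1   : ∀ {a c r} → place a c (suc r) ⟶ afterPlace (suc a) c r
  put3   : ∀ {a c r} → place a c (suc (suc (suc r))) ⟶ afterPlace a (suc c) r
  add12  : ∀ {a b c} → decomp (suc a) (suc b) c ⟶ decomp a b (suc c)
  add23  : ∀ {a b c} → decomp a (suc b) (suc c) ⟶ decomp a b c
  merge  : ∀ {a b c} → decomp (suc (suc a)) b c ⟶ decomp a (suc b) c
  split2 : ∀ {a b c} → decomp a (suc (suc b)) c ⟶ decomp (suc a) b (suc c)
  split3 : ∀ {a b c} → decomp a b (suc (suc c)) ⟶ decomp (suc a) b c

-- Normal play, well-founded (finite) winning strategies:
--   Win p  : the player to move from p has a winning strategy;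
--   Lose p : the player not to move from p has a winning strategy.
data Win  : Position → Set
data Lose : Position → Set

data Win where
  win : ∀ {p q} → p ⟶ q → Lose q → Win p

data Lose where
  lose : ∀ {p} → (∀ q → p ⟶ q → Win q) → Lose p

Player1Wins : ℕ → Set
Player1Wins n = Win (start n)

Player2Wins : ℕ → Set
Player2Wins n = Lose (start n)

residuesP2 : List ℕ
residuesP2 = 0 ∷ 2 ∷ 4 ∷ 6 ∷ 9 ∷ 11 ∷ 13 ∷ []

residuesP1 : List ℕ
residuesP1 = 1 ∷ 3 ∷ 5 ∷ 7 ∷ 8 ∷ 10 ∷ 12 ∷ 14 ∷ 15 ∷ []

{-# OPTIONS --safe #-}
module Submission where

-- In the decomposition phase, the boards (a, b, c) with b ≤ 1 from which the player to move
-- loses are invariant under (a, c) ↦ (a + 3, c + 4) and otherwise given by a few boundary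
-- rows.  A set of boards from which every move can be answered by a move back into the set
-- consists of second-player wins; this closedness is again invariant under the translation,
-- so it only has to be checked on two boundary strips, where it is evaluated.  In the
-- placement phase the second player answers a 1 with a 3 and a 3 with a 1: from n = 4t + r
-- this reaches the board (t, 0, t) with r ≤ 3 still to place, and the last placements are
-- examined directly.  Far below the diagonal the losing boards do not depend on a, so the
-- outcome is 16-periodic in n from n = 208 on, and the residues with their four exceptions
-- are read off by evaluating n < 224.

open import Defs
open import Data.Bool using (Bool; true; false; T; _∧_; _∨_; not; if_then_else_)
open import Data.Bool.ListAction using (any; all)
open import Data.Bool.Properties using (T-∧; T-∨; _≟_)
open import Data.List using (List; []; _∷_; _++_; upTo)
open import Data.List.Membership.Propositional using (_∈_)
open import Data.List.Membership.Propositional.Properties using (∈-++⁺ʳ; ∈-upTo⁺)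
open import Data.List.Relation.Unary.All as All using ()
open import Data.List.Relation.Unary.All.Properties using (all⁺)
open import Data.List.Relation.Unary.Any using (here; there; satisfied)
open import Data.List.Relation.Unary.Any.Properties using (any⁻)
open import Data.Nat
  using (ℕ; zero; suc; _+_; _*_; _%_; _<_; _≤_; _<?_; _≤ᵇ_; _≡ᵇ_; NonZero; z≤n; s≤s; s≤s⁻¹; >-nonZero⁻¹)
open import Data.Nat.Divisibility using (∣-refl)
open import Data.Nat.DivMod using (%-remove-+ˡ)
open import Data.Nat.Induction using (<-rec)
open import Data.Nat.Properties
  using (≤-refl; ≤-trans; <-trans; <-≤-trans; <⇒≱; ≮⇒≥; ≤ᵇ⇒≤; m≤n+m; m≤n⇒m≤1+n; m<n+m;
         m≤n⇒∃[o]m+o≡n; +-monoˡ-<; +-cancelˡ-≤; *-cancelʳ-≤)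
  renaming (_≟_ to _≟ℕ_)
open import Data.List.Membership.DecPropositional _≟ℕ_ using (_∈?_)
open import Data.Nat.Tactic.RingSolver using (solve-∀)
open import Data.Product using (∃; ∃-syntax; _×_; _,_; proj₁; proj₂)
open import Data.Sum using (_⊎_; inj₁; inj₂)
open import Function using (_∘_; Equivalence)
open import Relation.Binary.PropositionalEquality
  using (_≡_; _≢_; refl; sym; trans; subst; cong₂; module ≡-Reasoning)
open import Relation.Nullary using (Dec; yes; no; ¬?; contradiction)
open import Relation.Nullary.Decidable
  using (⌊_⌋; toWitness; from-yes; T?; _×-dec_; _→-dec_)

open ≡-Reasoning

split-at : ∀ {P : ℕ → Set} N → (∀ n → n < N → P n) → (∀ k → P (N + k)) → ∀ n → P n
split-at zero below beyond n = beyond n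
split-at (suc N) below beyond zero = below zero (s≤s z≤n)
split-at {P} (suc N) below beyond (suc n) =
  split-at {P ∘ suc} N (λ n n<N → below (suc n) (s≤s n<N)) beyond n

all-upTo : ∀ (f : ℕ → Bool) {n m} → T (all f (upTo n)) → m < n → T (f m)
all-upTo f {n} table m<n = All.lookup (all⁺ f (upTo n) table) (∈-upTo⁺ m<n)

eventually-true : ∀ (f : ℕ → Bool) N →
  T (all f (upTo N)) → (∀ k → T (f (N + k))) → ∀ n → T (f n)
eventually-true f N table beyond = split-at N (λ _ → all-upTo f table) beyond

periodic-induction : ∀ {P : ℕ → Set} n₀ p .{{_ : NonZero p}} →
  (∀ n → n < p + n₀ → P n) → (∀ n → P (n₀ + n) → P (p + n₀ + n)) → ∀ n → P n
periodic-induction {P} n₀ p base step = <-rec P go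
  where
  go : ∀ n → (∀ {m} → m < n → P m) → P n
  go n rec with n <? p + n₀
  ... | yes n<p+n₀ = base n n<p+n₀
  ... | no n≮p+n₀ with k , refl ← m≤n⇒∃[o]m+o≡n (≮⇒≥ n≮p+n₀) =
    step k (rec (+-monoˡ-< k (m<n+m n₀ (>-nonZero⁻¹ p))))

translation-induction : ∀ {P : ℕ → ℕ → Set} a₀ c₀ p q .{{_ : NonZero q}} →
  (∀ a c → a < p + a₀ → P a c) →
  (∀ a c → c < q + c₀ → P a c) →
  (∀ a c → P (a₀ + a) (c₀ + c) → P (p + a₀ + a) (q + c₀ + c)) →
  ∀ a c → P a c
translation-induction {P} a₀ c₀ p q left bottom step a c =
  periodic-induction {λ c → ∀ a → P a c} c₀ q (λ c c< a → bottom a c c<) column c a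
  where
  column : ∀ c → (∀ a → P a (c₀ + c)) → ∀ a → P a (q + c₀ + c)
  column c ih = split-at (p + a₀) (λ a a< → left a _ a<) (λ a → step a c (ih (a₀ + a)))

Move : Position → Set
Move p = ∃ (p ⟶_)

private
  add12s add23s merges split2s split3s : ∀ a b c → List (Move (decomp a b c))
  add12s (suc a) (suc b) c = (_ , add12) ∷ []
  add12s _ _ _ = []
  add23s a (suc b) (suc c) = (_ , add23) ∷ []
  add23s _ _ _ = []
  merges (suc (suc a)) b c = (_ , merge) ∷ []
  merges _ _ _ = []
  split2s a (suc (suc b)) c = (_ , split2) ∷ []
  split2s _ _ _ = []
  split3s a b (suc (suc c)) = (_ , split3) ∷ []
  split3s _ _ _ = []

moves : (p : Position) → List (Move p)
moves (place a c (suc (suc (suc r)))) = (_ , put1) ∷ (_ , put3) ∷ []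
moves (place a c (suc r)) = (_ , put1) ∷ []
moves (place a c zero) = []
moves (decomp a b c) =
  add12s a b c ++ add23s a b c ++ merges a b c ++ split2s a b c ++ split3s a b c

moves-complete : ∀ {p q} (m : p ⟶ q) → (q , m) ∈ moves p
moves-complete (put1 {r = zero}) = here refl
moves-complete (put1 {r = suc zero}) = here refl
moves-complete (put1 {r = suc (suc r)}) = here refl
moves-complete put3 = there (here refl)
moves-complete add12 = here refl
moves-complete (add23 {a} {b} {c}) =
  ∈-++⁺ʳ (add12s a (suc b) (suc c)) (here refl)
moves-complete (merge {a} {b} {c}) =
  ∈-++⁺ʳ (add12s (2 + a) b c) (∈-++⁺ʳ (add23s (2 + a) b c) (here refl))
moves-complete (split2 {a} {b} {c}) =
  ∈-++⁺ʳ (add12s a (2 + b) c) (∈-++⁺ʳ (add23s a (2 + b) c)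
    (∈-++⁺ʳ (merges a (2 + b) c) (here refl)))
moves-complete (split3 {a} {b} {c}) =
  ∈-++⁺ʳ (add12s a b (2 + c)) (∈-++⁺ʳ (add23s a b (2 + c))
    (∈-++⁺ʳ (merges a b (2 + c)) (∈-++⁺ʳ (split2s a b (2 + c)) (here refl))))

μ : Position → ℕ
μ (place a c r) = (a + c) * 3 + r * 4
μ (decomp a b c) = (a + c) * 3 + b * 4

μ-afterPlace : ∀ a c r → μ (afterPlace a c r) ≡ μ (place a c r)
μ-afterPlace a c zero = refl
μ-afterPlace a c (suc r) = refl

private
  drops-by : ∀ d {m n} → n ≡ suc d + m → m < n
  drops-by d refl = m<n+m _ (s≤s z≤n)

μ-decreasing : ∀ {p q} → p ⟶ q → μ q < μ p
μ-decreasing (put1 {a} {c} {r}) rewrite μ-afterPlace (suc a) c r = drops-by 0 (eq a c r)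
  where eq : ∀ a c r → (a + c) * 3 + suc r * 4 ≡ 1 + ((suc a + c) * 3 + r * 4)
        eq = solve-∀
μ-decreasing (put3 {a} {c} {r}) rewrite μ-afterPlace a (suc c) r = drops-by 8 (eq a c r)
  where eq : ∀ a c r → (a + c) * 3 + (3 + r) * 4 ≡ 9 + ((a + suc c) * 3 + r * 4)
        eq = solve-∀
μ-decreasing (add12 {a} {b} {c}) = drops-by 3 (eq a b c)
  where eq : ∀ a b c → (suc a + c) * 3 + suc b * 4 ≡ 4 + ((a + suc c) * 3 + b * 4)
        eq = solve-∀
μ-decreasing (add23 {a} {b} {c}) = drops-by 6 (eq a b c)
  where eq : ∀ a b c → (a + suc c) * 3 + suc b * 4 ≡ 7 + ((a + c) * 3 + b * 4)
        eq = solve-∀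
μ-decreasing (merge {a} {b} {c}) = drops-by 1 (eq a b c)
  where eq : ∀ a b c → (2 + a + c) * 3 + b * 4 ≡ 2 + ((a + c) * 3 + suc b * 4)
        eq = solve-∀
μ-decreasing (split2 {a} {b} {c}) = drops-by 1 (eq a b c)
  where eq : ∀ a b c → (a + c) * 3 + (2 + b) * 4 ≡ 2 + ((suc a + suc c) * 3 + b * 4)
        eq = solve-∀
μ-decreasing (split3 {a} {b} {c}) = drops-by 2 (eq a b c)
  where eq : ∀ a b c → (a + (2 + c)) * 3 + b * 4 ≡ 3 + ((suc a + c) * 3 + b * 4)
        eq = solve-∀

module Certificate (L : Position → Bool) where

  Winning : Position → Bool
  Winning p = any (L ∘ proj₁) (moves p)

  Closed : Position → Bool
  Closed p = if L p then all (Winning ∘ proj₁) (moves p) else true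

  winning-move : ∀ {p} → T (Winning p) → ∃[ q ] (p ⟶ q × T (L q))
  winning-move {p} w with (q , m) , Lq ← satisfied (any⁻ _ (moves p) w) = q , m , Lq

  closed-reply : ∀ {p q} → T (Closed p) → T (L p) → p ⟶ q → T (Winning q)
  closed-reply {p} closed Lp m with L p
  ... | true = All.lookup (all⁺ _ (moves p) closed) (moves-complete m)

  module _ (closed : ∀ p → T (Closed p)) where

    L⇒Lose : ∀ {p} → T (L p) → Lose p
    L⇒Lose {p} = go (suc (μ p)) (s≤s ≤-refl)
      where
      go : ∀ n {p} → μ p < n → T (L p) → Lose p
      go (suc n) μp<n Lp = lose λ q m →
        let r , m′ , Lr = winning-move (closed-reply (closed _) Lp m)
            μr<n = <-trans (μ-decreasing m′) (<-≤-trans (μ-decreasing m) (s≤s⁻¹ μp<n))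
        in win m′ (go n μr<n Lr)

    Winning⇒Win : ∀ {p} → T (Winning p) → Win p
    Winning⇒Win w = let q , m , Lq = winning-move w in win m (L⇒Lose Lq)

-- These are exactly the decomposition boards with b ≤ 1 lost by the player to move, but only
-- closedness is proved and used; no board with b ≥ 2 is needed.
losing₀ losing₁ : ℕ → ℕ → Bool
losing₀ (suc (suc (suc a))) (suc (suc (suc (suc c)))) = losing₀ a c
losing₀ 0 c = (c ≤ᵇ 1) ∨ (c ≡ᵇ 5)
losing₀ 1 c = not (c ≡ᵇ 3)
losing₀ 2 c = c ≡ᵇ 1
losing₀ _ c = c ≤ᵇ 1
losing₁ (suc (suc (suc a))) (suc (suc (suc (suc c)))) = losing₁ a c
losing₁ 0 c = not ((c ≡ᵇ 1) ∨ (c ≡ᵇ 2) ∨ (c ≡ᵇ 6))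
losing₁ 3 3 = true
losing₁ 6 3 = true
losing₁ _ _ = false

losing : Position → Bool
losing (decomp a 0 c) = losing₀ a c
losing (decomp a 1 c) = losing₁ a c
losing _ = false

open Certificate losing

Closed₀₁ : ℕ → ℕ → Bool
Closed₀₁ a c = Closed (decomp a 0 c) ∧ Closed (decomp a 1 c)

-- For a, c ≥ 4 the translation by (3, 4) maps the moves of a board and of its successors onto
-- those of the image, so the step case holds by computation.  On the two strips the check
-- reduces to true beyond a finite table, since a large symbolic coordinate only meets
-- catch-all clauses.
closed₀₁ : ∀ a c → T (Closed₀₁ a c)
closed₀₁ = translation-induction 4 4 3 4 left bottom (λ _ _ ih → ih)
  where
  left : ∀ a c → a < 7 → T (Closed₀₁ a c)
  left a c a<7 = all-upTo (λ a → Closed₀₁ a c)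
    (eventually-true (λ c → all (λ a → Closed₀₁ a c) (upTo 7)) 20 _ (λ _ → _) c) a<7
  bottom : ∀ a c → c < 8 → T (Closed₀₁ a c)
  bottom a c c<8 = all-upTo (Closed₀₁ a)
    (eventually-true (λ a → all (Closed₀₁ a) (upTo 8)) 20 _ (λ _ → _) a) c<8

closed : ∀ p → T (Closed p)
closed (place _ _ _) = _
closed (decomp a 0 c) = proj₁ (Equivalence.to T-∧ (closed₀₁ a c))
closed (decomp a 1 c) = proj₂ (Equivalence.to T-∧ (closed₀₁ a c))
closed (decomp a (suc (suc b)) c) = _

losing⇒Lose : ∀ {p} → T (losing p) → Lose p
losing⇒Lose = L⇒Lose closed

winning⇒Win : ∀ {p} → T (Winning p) → Win p
winning⇒Win = Winning⇒Win closed

-- Certifies Lose (afterPlace a c r).  While r ≥ 4 the second player answers a 1 with a 3 and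
-- a 3 with a 1; with r ≤ 3 left only the first placement of r = 3 is a choice.
losingPlacement : ℕ → ℕ → ℕ → Bool
losingPlacement a c 0 = losing (decomp a 0 c)
losingPlacement a c 1 = Winning (decomp (suc a) 0 c)
losingPlacement a c 2 = losingPlacement (2 + a) c 0
losingPlacement a c 3 = losingPlacement (2 + a) c 1 ∧ Winning (decomp a 0 (suc c))
losingPlacement a c (suc (suc (suc (suc r)))) = losingPlacement (suc a) (suc c) r

losingPlacement⇒Lose : ∀ a c r → T (losingPlacement a c r) → Lose (afterPlace a c r)
losingPlacement⇒Lose a c 0 h = losing⇒Lose h
losingPlacement⇒Lose a c 1 h = lose λ { _ put1 → winning⇒Win h }
losingPlacement⇒Lose a c 2 h = lose λ { _ put1 → win put1 (losing⇒Lose h) }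
losingPlacement⇒Lose a c 3 h with Equivalence.to T-∧ h
... | h₁ , h₃ = lose λ
  { _ put1 → win put1 (losingPlacement⇒Lose (2 + a) c 1 h₁)
  ; _ put3 → winning⇒Win h₃ }
losingPlacement⇒Lose a c (suc (suc (suc (suc r)))) h = lose λ
  { _ put1 → win put3 (losingPlacement⇒Lose (suc a) (suc c) r h)
  ; _ put3 → win put1 (losingPlacement⇒Lose (suc a) (suc c) r h) }

winningPlacement : ℕ → ℕ → ℕ → Bool
winningPlacement a c 0 = false
winningPlacement a c 1 = losingPlacement (suc a) c 0
winningPlacement a c 2 = losingPlacement (suc a) c 1
winningPlacement a c (suc (suc (suc r))) =
  losingPlacement (suc a) c (2 + r) ∨ losingPlacement a (suc c) r

winningPlacement⇒Win : ∀ a c r → T (winningPlacement a c r) → Win (afterPlace a c r)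
winningPlacement⇒Win a c 1 h = win put1 (losingPlacement⇒Lose (suc a) c 0 h)
winningPlacement⇒Win a c 2 h = win put1 (losingPlacement⇒Lose (suc a) c 1 h)
winningPlacement⇒Win a c (suc (suc (suc r))) h with Equivalence.to T-∨ h
... | inj₁ h₁ = win put1 (losingPlacement⇒Lose (suc a) c (2 + r) h₁)
... | inj₂ h₃ = win put3 (losingPlacement⇒Lose a (suc c) r h₃)

-- Translating by (−3, −4) until c < 4 leaves a ≥ 12, where the boundary rows no longer depend
-- on a.
Far : ℕ → ℕ → Set
Far a c = c * 3 + 48 ≤ a * 4

Far⇒12≤ : ∀ {a} c → Far a c → 12 ≤ a
Far⇒12≤ {a} c far = *-cancelʳ-≤ 12 a 4 (≤-trans (m≤n+m 48 (c * 3)) far)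

Far-diagonal : ∀ a c → Far a c → Far (suc a) (suc c)
Far-diagonal a c far = s≤s (s≤s (s≤s (m≤n⇒m≤1+n far)))

losingPlacement-translate : ∀ r a c →
  losingPlacement (5 + a) (6 + c) r ≡ losingPlacement (2 + a) (2 + c) r
losingPlacement-translate 0 a c = refl
losingPlacement-translate 1 a c = refl
losingPlacement-translate 2 a c = refl
losingPlacement-translate 3 a c = refl
losingPlacement-translate (suc (suc (suc (suc r)))) a c =
  losingPlacement-translate r (suc a) (suc c)

private
  ≟-sound : ∀ {x y : Bool} → T ⌊ x ≟ y ⌋ → x ≡ y
  ≟-sound {x} {y} = toWitness {a? = x ≟ y}

losingPlacement-far : ∀ a c → Far a c → ∀ r → r < 4 →
  losingPlacement (suc a) c r ≡ losingPlacement a c r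
losingPlacement-far = translation-induction 2 2 3 4 left bottom step
  where
  Independent : ℕ → ℕ → Set
  Independent a c =
    Far a c → ∀ r → r < 4 → losingPlacement (suc a) c r ≡ losingPlacement a c r

  left : ∀ a c → a < 5 → Independent a c
  left a c a<5 far = contradiction (Far⇒12≤ c far) (<⇒≱ (<-≤-trans a<5 (≤ᵇ⇒≤ 5 12 _)))

  agrees : ℕ → ℕ → ℕ → Bool
  agrees x c r = ⌊ losingPlacement (13 + x) c r ≟ losingPlacement (12 + x) c r ⌋

  table : ∀ x → T (all (λ c → all (agrees x c) (upTo 4)) (upTo 6))
  table _ = _

  bottom : ∀ a c → c < 6 → Independent a c
  bottom a c c<6 far r r<4 =
    let x , 12+x≡a = m≤n⇒∃[o]m+o≡n (Far⇒12≤ c far)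
        row = all-upTo (λ c → all (agrees x c) (upTo 4)) (table x) c<6
    in subst (λ a → losingPlacement (suc a) c r ≡ losingPlacement a c r) 12+x≡a
         (≟-sound (all-upTo (agrees x c) row r<4))

  step : ∀ a c → Independent (2 + a) (2 + c) → Independent (5 + a) (6 + c)
  step a c ih far r r<4 = begin
    losingPlacement (6 + a) (6 + c) r ≡⟨ losingPlacement-translate r (suc a) c ⟩
    losingPlacement (3 + a) (2 + c) r ≡⟨ ih (+-cancelˡ-≤ 12 _ _ far) r r<4 ⟩
    losingPlacement (2 + a) (2 + c) r ≡⟨ losingPlacement-translate r a c ⟨
    losingPlacement (5 + a) (6 + c) r ∎

losingPlacement-periodic : ∀ r a c → Far (2 + a) (2 + c) →
  losingPlacement (6 + a) (6 + c) r ≡ losingPlacement (2 + a) (2 + c) r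
losingPlacement-periodic = periodic-induction 0 4 endgame
  (λ r ih a c far → ih (suc a) (suc c) (Far-diagonal (2 + a) (2 + c) far))
  where
  endgame : ∀ r → r < 4 → ∀ a c → Far (2 + a) (2 + c) →
    losingPlacement (6 + a) (6 + c) r ≡ losingPlacement (2 + a) (2 + c) r
  endgame r r<4 a c far =
    trans (losingPlacement-translate r (suc a) c) (losingPlacement-far (2 + a) (2 + c) far r r<4)

Claim : ℕ → Set
Claim n = ((n % 16) ∈ residuesP2 → n ≢ 2 → n ≢ 32 → T (losingPlacement 0 0 n))
        × ((n % 16) ∈ residuesP1 → n ≢ 17 → n ≢ 47 → T (winningPlacement 0 0 n))

claim? : ∀ n → Dec (Claim n)
claim? n = ((n % 16) ∈? residuesP2 →-dec ¬? (n ≟ℕ 2) →-dec ¬? (n ≟ℕ 32) →-dec T? _)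
     ×-dec ((n % 16) ∈? residuesP1 →-dec ¬? (n ≟ℕ 17) →-dec ¬? (n ≟ℕ 47) →-dec T? _)

-- 208 = 4 · 52: for n ≥ 208 mirroring passes through the boards (52, 52), (52, 51) and
-- (51, 52), the first ones on their diagonals that are Far.
claim : ∀ n → Claim n
claim = periodic-induction 208 16 small large
  where
  small : ∀ n → n < 224 → Claim n
  small n n<224 = All.lookup (from-yes (All.all? claim? (upTo 224))) (∈-upTo⁺ n<224)

  large : ∀ n → Claim (208 + n) → Claim (224 + n)
  large n (second , first) =
      (λ mem _ _ → subst T (sym second-periodic)
                     (second (subst (_∈ residuesP2) residue mem) (λ ()) (λ ())))
    , (λ mem _ _ → subst T (sym first-periodic)
                     (first (subst (_∈ residuesP1) residue mem) (λ ()) (λ ())))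
    where
    residue : (224 + n) % 16 ≡ (208 + n) % 16
    residue = %-remove-+ˡ {16} (208 + n) ∣-refl
    second-periodic : losingPlacement 0 0 (224 + n) ≡ losingPlacement 0 0 (208 + n)
    second-periodic = losingPlacement-periodic n 50 50 (≤ᵇ⇒≤ _ _ _)
    first-periodic : winningPlacement 0 0 (224 + n) ≡ winningPlacement 0 0 (208 + n)
    first-periodic = cong₂ _∨_ (losingPlacement-periodic (3 + n) 50 49 (≤ᵇ⇒≤ _ _ _))
                               (losingPlacement-periodic (1 + n) 49 50 (≤ᵇ⇒≤ _ _ _))

theorem5p19 : (n : ℕ) → 0 < n →
    ((n % 16) ∈ residuesP2 →
      ((n ≢ 2 → n ≢ 32 → Player2Wins n) × (n ≡ 2 ⊎ n ≡ 32 → Player1Wins n)))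
    ×
    ((n % 16) ∈ residuesP1 →
      ((n ≢ 17 → n ≢ 47 → Player1Wins n) × (n ≡ 17 ⊎ n ≡ 47 → Player2Wins n)))
theorem5p19 n _ =
    (λ mem → (λ n≢2 n≢32 → losingPlacement⇒Lose 0 0 n (proj₁ (claim n) mem n≢2 n≢32))
           , λ { (inj₁ refl) → winningPlacement⇒Win 0 0 2 _
               ; (inj₂ refl) → winningPlacement⇒Win 0 0 32 _ })
  , (λ mem → (λ n≢17 n≢47 → winningPlacement⇒Win 0 0 n (proj₂ (claim n) mem n≢17 n≢47))
           , λ { (inj₁ refl) → losingPlacement⇒Lose 0 0 17 _
               ; (inj₂ refl) → losingPlacement⇒Lose 0 0 47 _ })
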